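{- The worst-case running time of Zielonka's recursive algorithm on dull parity games, as a function of the number of vertices $|V|$, is $\Omega(2^{|V|/3})$.
   Context: A parity game $G=(V,E,\mathcal{P},(V_\Diamond,V_\Box))$ consists of a finite vertex set $V$ partitioned into $V_\Diamond$ (owned by player even, $\Diamond$) and $V_\Box$ (owned by player odd, $\Box$), a total edge relation $E\subseteq V\times V$ (write $v\to w$) and a priority function $\mathcal{P}:V\to\mathbb{N}$. Player $\Diamond$ wins an infinite play iff the highest priority occurring infinitely often is even; a vertex is won by player $i$ if $i$ has a strategy winning every consistent play from it; solving means computing the winning regions $(W_\Diamond,W_\Box)$. For $A\subseteq V$, $G\setminus A$ is the game restricted to $V\setminus A$. $\overline{i}$ is the opponent of $i$. The $i$-attractor $\mathit{Attr}_i(U)$ of $U\subseteq V$ is the least superset of $U$ closed under adding vertices of $V_i$ having some successor in the set and vertices of $V_{\overline i}$ all of whose successors are in the set. Zielonka's algorithm $\textsc{Zielonka}(G)$: if $V=\emptyset$ return $(\emptyset,\emptyset)$. Otherwise let $m$ be the maximal priority, $p=\Diamond$ if $m$ even else $p=\Box$, $U=\{v\mid\mathcal{P}(v)=m\}$, $A=\mathit{Attr}_p(U)$, $(W'_\Diamond,W'_\Box)=\textsc{Zielonka}(G\setminus A)$. If $W'_{\overline p}=\emptyset$, return $W_p=A\cup W'_p$, $W_{\overline p}=\emptyset$. Otherwise let $B=\mathit{Attr}_{\overline p}(W'_{\overline p})$, $(W''_\Diamond,W''_\Box)=\textsc{Zielonka}(G\setminus B)$, and return $W_p=W''_p$, $W_{\overline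 p}=W''_{\overline p}\cup B$. A basic cycle is a finite path $v_1,\dots,v_n$ with $v_n\to v_1$ and no repeated vertex; it is even (odd) if the highest priority on it is even (odd). A parity game is dull if every even basic cycle is vertex-disjoint from every odd basic cycle. -}

module Defs where

open import Data.Bool using (Bool; true; false; _∧_; _∨_; not; if_then_else_)
open import Data.Nat using (ℕ; zero; suc; _+_; _⊔_; _≡ᵇ_)
open import Data.Fin using (Fin)
open import Data.List using (List; []; _∷_; allFin; map; foldr)
open import Data.Bool.ListAction using (any; all)
open import Data.List.Relation.Unary.Unique.Propositional using (Unique)
open import Data.List.Relation.Unary.Linked using (Linked)
open import Data.List.Membership.Propositional using (_∈_)
open import Data.Product using (Σ; ∃; _×_; _,_; proj₁; proj₂)
open import Data.Empty using (⊥)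
open import Relation.Binary.PropositionalEquality using (_≡_)

data Player : Set where
  ◇ □ : Player      -- ◇ = player even, □ = player odd

opp : Player → Player
opp ◇ = □
opp □ = ◇

_==P_ : Player → Player → Bool
◇ ==P ◇ = true
□ ==P □ = true
_ ==P _ = false

isEven : ℕ → Bool
isEven zero = true
isEven (suc n) = not (isEven n)

playerOf : ℕ → Player
playerOf m = if isEven m then ◇ else □

-- Parity games on the vertex set Fin n (so |V| = n)

record Game (n : ℕ) : Set where
  field
    owner : Fin n → Player
    edge  : Fin n → Fin n → Bool
    prio  : Fin n → ℕ
    total : ∀ v → ∃ λ w → edge v w ≡ true

open Game public

-- Subsets of V as Boolean predicates (subgames are given by subsets)

VSet : ℕ → Set
VSet n = Fin n → Bool

∅ : ∀ {n} → VSet n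
∅ _ = false

_∪_ : ∀ {n} → VSet n → VSet n → VSet n
(X ∪ Y) v = X v ∨ Y v

_∩_ : ∀ {n} → VSet n → VSet n → VSet n
(X ∩ Y) v = X v ∧ Y v

_∖_ : ∀ {n} → VSet n → VSet n → VSet n
(X ∖ Y) v = X v ∧ not (Y v)

isEmpty : ∀ {n} → VSet n → Bool
isEmpty {n} X = not (any X (allFin n))

-- maximal priority of a vertex in S (0 if S is empty)
maxPrio : ∀ {n} → Game n → VSet n → ℕ
maxPrio {n} G S = foldr (λ v m → if S v then prio G v ⊔ m else m) 0 (allFin n)

-- Attractor Attr_i(U) computed in the subgame G restricted to S.

attrStep : ∀ {n} → Game n → VSet n → Player → VSet n → VSet n
attrStep {n} G S i X v =
  X v ∨ (S v ∧
    (if owner G v ==P i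
      then any (λ w → S w ∧ edge G v w ∧ X w) (allFin n)
      else all (λ w → not (S w ∧ edge G v w) ∨ X w) (allFin n)))

iterate : ∀ {A : Set} → ℕ → (A → A) → A → A
iterate zero f x = x
iterate (suc k) f x = f (iterate k f x)

-- n iterations reach the least fixpoint (at most n vertices can be added)
attr : ∀ {n} → Game n → VSet n → Player → VSet n → VSet n
attr {n} G S i U = iterate n (attrStep G S i) (U ∩ S)

-- The first argument is fuel;
-- every recursive call is on a strictly smaller subgame, so fuel n
-- (n = |V|) is never exhausted when started on the whole game.

Result : ℕ → Set
Result n = (Player → VSet n) × ℕ      -- winning regions W_◇, W_□ and call count

pick : ∀ {n} → Player → VSet n → VSet n → VSet n
pick ◇ a b = a
pick □ a b = b

regions : ∀ {n} → Player → VSet n → VSet n → (Player → VSet n)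
regions p Wp Wo q = if q ==P p then Wp else Wo

zielonka : ∀ {n} → Game n → ℕ → VSet n → Result n
zielonka G zero S = (λ _ → ∅) , 1
zielonka G (suc k) S =
  if isEmpty S then ((λ _ → ∅) , 1) else
  (let m  = maxPrio G S
       p  = playerOf m
       U  = λ v → S v ∧ (prio G v ≡ᵇ m)
       A  = attr G S p U
       r1 = zielonka G k (S ∖ A)
       W' = proj₁ r1
   in if isEmpty (W' (opp p))
      then (regions p (A ∪ W' p) ∅ , suc (proj₂ r1))
      else
        (let B  = attr G S (opp p) (W' (opp p))
             r2 = zielonka G k (S ∖ B)
             W″ = proj₁ r2
         in regions p (W″ p) (W″ (opp p) ∪ B) , suc (proj₂ r1 + proj₂ r2)))

full : ∀ {n} → VSet n
full _ = true

zielonkaCalls : ∀ {n} → Game n → ℕ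
zielonkaCalls {n} G = proj₂ (zielonka G n full)

lastOf : ∀ {n} → Fin n → List (Fin n) → Fin n
lastOf v [] = v
lastOf v (w ∷ ws) = lastOf w ws

IsBasicCycle : ∀ {n} → Game n → List (Fin n) → Set
IsBasicCycle {n} G cs =
  Σ (Fin n) λ v → Σ (List (Fin n)) λ vs →
    (cs ≡ v ∷ vs) ×
    Linked (λ x y → edge G x y ≡ true) cs ×
    (edge G (lastOf v vs) v ≡ true) ×
    Unique cs

maxPrioList : ∀ {n} → Game n → List (Fin n) → ℕ
maxPrioList G cs = foldr _⊔_ 0 (map (prio G) cs)

EvenCycle : ∀ {n} → Game n → List (Fin n) → Set
EvenCycle G cs = IsBasicCycle G cs × (isEven (maxPrioList G cs) ≡ true)

OddCycle : ∀ {n} → Game n → List (Fin n) → Set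
OddCycle G cs = IsBasicCycle G cs × (isEven (maxPrioList G cs) ≡ false)

Dull : ∀ {n} → Game n → Set
Dull {n} G = ∀ (c d : List (Fin n)) → EvenCycle G c → OddCycle G d →
             ∀ v → v ∈ c → v ∈ d → ⊥

-- The ladder has, for every b, vertices x_b, y_b, z_b of priorities 2b, 2b+1, 2b+1, and apart from
-- self-loops only the moves y_b → z_(b+1) → x_(b+1).  These lower the rank y > z > x, so every basic
-- cycle is a self-loop and the ladder is dull.  On the ladder cut after x_(i+1), Zielonka's algorithm
-- removes x_(i+1), then y_i and z_i, and recurses into the ladder cut after x_i; the ◇-attractor of
-- what ◇ wins there leaves only y_i to □, and once y_i is removed, a second recursion (after removing
-- x_(i+1) and z_i) meets the ladder cut after x_i again.  So the number of calls doubles from block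
-- to block, giving 2^(n/3) calls on n vertices.  Every set met in these runs is determined, relative
-- to the current block i, by the kinds of vertices it contains in each of five zones of blocks, so
-- the attractors are computed on these finite patterns by evaluation.

module Submission where

open import Defs
open import Data.Bool using (Bool; true; false; _∧_; _∨_; not; if_then_else_)
open import Data.Bool.ListAction using (any; all; or)
open import Data.Bool.Properties
  using (∧-conicalˡ; ∧-conicalʳ; ∧-zeroʳ; ∧-identityʳ; ∨-zeroʳ; ∨-identityʳ; T-≡)
open import Data.Empty using (⊥-elim)
open import Data.Fin using (Fin; toℕ; fromℕ<)
open import Data.Fin.Properties using (toℕ-injective; toℕ-fromℕ<; toℕ<n)
open import Data.List using (List; []; _∷_; allFin; foldr; cartesianProduct)
open import Data.List.Properties using (map-cong)
open import Data.List.Membership.Propositional using (_∈_)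
open import Data.List.Membership.Propositional.Properties using (∈-allFin; ∈-cartesianProduct⁺)
open import Data.List.Relation.Unary.All as All using (_∷_)
open import Data.List.Relation.Unary.AllPairs using (AllPairs; _∷_)
open import Data.List.Relation.Unary.Any using (here; there)
open import Data.List.Relation.Unary.Linked using (Linked; _∷_)
open import Data.Nat using (ℕ; zero; suc; _+_; _*_; _^_; _⊔_; _≡ᵇ_; _≤ᵇ_; _≤_; _<_; z≤n; s≤s)
open import Data.Nat.DivMod using (_/_; /-monoˡ-≤; m*n/n≡m)
open import Data.Nat.Properties
  using (≤-refl; ≤-trans; <-trans; <-asym; ≤-antisym; <⇒≤; n≤1+n; n<1+n; m≤m+n;
         m≤m⊔n; m≤n⊔m; ⊔-lub; +-suc; +-identityʳ; +-mono-≤; *-monoʳ-≤; ^-monoʳ-≤; ≡ᵇ⇒≡; ≡⇒≡ᵇ; ≤⇒≤ᵇ)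
open import Data.Product using (∃; _×_; _,_; proj₁; proj₂; uncurry)
open import Data.Sum using (_⊎_; inj₁; inj₂)
open import Function.Bundles using (Equivalence)
open import Relation.Binary.PropositionalEquality

∨-true-split : ∀ {a b} → a ∨ b ≡ true → a ≡ true ⊎ b ≡ true
∨-true-split {true}  _ = inj₁ refl
∨-true-split {false} h = inj₂ h

∨-trueˡ : ∀ {a} b → a ≡ true → a ∨ b ≡ true
∨-trueˡ b refl = refl

∨-trueʳ : ∀ a {b} → b ≡ true → a ∨ b ≡ true
∨-trueʳ a refl = ∨-zeroʳ a

∧-true : ∀ {a b} → a ≡ true → b ≡ true → a ∧ b ≡ true
∧-true refl h = h

not-true : ∀ {a} → not a ≡ true → a ≡ false
not-true {false} _ = refl

true≢false : true ≢ false
true≢false ()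

bool-ext : ∀ {a b} → (a ≡ true → b ≡ true) → (b ≡ true → a ≡ true) → a ≡ b
bool-ext {false} {false} _ _ = refl
bool-ext {false} {true}  _ g = g refl
bool-ext {true}  {b}     f _ = sym (f refl)

≡ᵇ-true⇒≡ : ∀ m n → (m ≡ᵇ n) ≡ true → m ≡ n
≡ᵇ-true⇒≡ m n h = ≡ᵇ⇒≡ m n (Equivalence.from T-≡ h)

≡ᵇ-refl : ∀ m → (m ≡ᵇ m) ≡ true
≡ᵇ-refl m = Equivalence.to T-≡ (≡⇒≡ᵇ m m refl)

module _ {A : Set} (p : A → Bool) where

  any-∈ : ∀ {xs x} → x ∈ xs → p x ≡ true → any p xs ≡ true
  any-∈ {y ∷ _}  (here refl) h = ∨-trueˡ _ h
  any-∈ {y ∷ ys} (there x∈)  h = ∨-trueʳ (p y) (any-∈ x∈ h)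

  any-witness : ∀ xs → any p xs ≡ true → ∃ λ x → p x ≡ true
  any-witness (y ∷ ys) h with ∨-true-split {p y} h
  ... | inj₁ py = y , py
  ... | inj₂ h′ = any-witness ys h′

  any-none : ∀ xs → (∀ x → p x ≡ false) → any p xs ≡ false
  any-none []       _ = refl
  any-none (y ∷ ys) h rewrite h y = any-none ys h


  all-∈ : ∀ {xs x} → x ∈ xs → all p xs ≡ true → p x ≡ true
  all-∈ {y ∷ _}  (here refl) h = ∧-conicalˡ _ _ h
  all-∈ {y ∷ ys} (there x∈)  h = all-∈ x∈ (∧-conicalʳ (p y) _ h)

any-cong : ∀ {A : Set} {p q : A → Bool} → p ≗ q → ∀ xs → any p xs ≡ any q xs
any-cong p≗q xs = cong or (map-cong p≗q xs)

all≡not-any-not : ∀ {A : Set} (p : A → Bool) xs → all p xs ≡ not (any (λ a → not (p a)) xs)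
all≡not-any-not p []       = refl
all≡not-any-not p (a ∷ as) with p a
... | true  = all≡not-any-not p as
... | false = refl

∧-swapˡ : ∀ a b c → a ∧ (b ∧ c) ≡ b ∧ (a ∧ c)
∧-swapˡ true  b c = refl
∧-swapˡ false b c = sym (∧-zeroʳ b)

not-guarded : ∀ a b c → not (not (a ∧ b) ∨ c) ≡ b ∧ (a ∧ not c)
not-guarded true  true  c = refl
not-guarded true  false c = refl
not-guarded false b     c = sym (∧-zeroʳ b)

≗-trans : ∀ {A B : Set} {f g h : A → B} → f ≗ g → g ≗ h → f ≗ h
≗-trans f≗g g≗h a = trans (f≗g a) (g≗h a)

isEmpty-false : ∀ {n} (S : VSet n) v → S v ≡ true → isEmpty S ≡ false
isEmpty-false {n} S v h rewrite any-∈ S (∈-allFin {n} v) h = refl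

isEmpty-true : ∀ {n} (S : VSet n) → (∀ v → S v ≡ false) → isEmpty S ≡ true
isEmpty-true {n} S h rewrite any-none S (allFin n) h = refl

maxPrio-attained : ∀ {n} (G : Game n) (S : VSet n) m v → S v ≡ true → prio G v ≡ m →
  (∀ w → S w ≡ true → prio G w ≤ m) → maxPrio G S ≡ m
maxPrio-attained {n} G S m v Sv refl bound = ≤-antisym (upper (allFin n)) (lower (allFin n) (∈-allFin v))
  where
  maxOf : List (Fin n) → ℕ
  maxOf = foldr (λ w k → if S w then prio G w ⊔ k else k) 0

  upper : ∀ ws → maxOf ws ≤ m
  upper []       = z≤n
  upper (w ∷ ws) with S w in Sw
  ... | true  = ⊔-lub (bound w Sw) (upper ws)
  ... | false = upper ws

  lower : ∀ ws → v ∈ ws → prio G v ≤ maxOf ws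
  lower (w ∷ ws) (here refl) rewrite Sv = m≤m⊔n _ _
  lower (w ∷ ws) (there v∈) with S w
  ... | true  = ≤-trans (lower ws v∈) (m≤n⊔m _ _)
  ... | false = lower ws v∈

iterate-suc : ∀ {A : Set} (f : A → A) k a → iterate (suc k) f a ≡ iterate k f (f a)
iterate-suc f zero    a = refl
iterate-suc f (suc k) a = cong f (iterate-suc f k a)

topSet : ∀ {n} → Game n → VSet n → ℕ → VSet n
topSet G S m v = S v ∧ (prio G v ≡ᵇ m)

topAttr : ∀ {n} → Game n → VSet n → ℕ → Player → VSet n
topAttr G S m p = attr G S p (topSet G S m)

firstCall : ∀ {n} → Game n → ℕ → VSet n → ℕ → Player → Result n
firstCall G k S m p = zielonka G k (S ∖ topAttr G S m p)

oppAttr : ∀ {n} → Game n → ℕ → VSet n → ℕ → Player → VSet n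
oppAttr G k S m p = attr G S (opp p) (proj₁ (firstCall G k S m p) (opp p))

secondCall : ∀ {n} → Game n → ℕ → VSet n → ℕ → Player → Result n
secondCall G k S m p = zielonka G k (S ∖ oppAttr G k S m p)

zielonkaStep : ∀ {n} → Game n → ℕ → VSet n → ℕ → Player → Result n
zielonkaStep G k S m p =
  if isEmpty (proj₁ (firstCall G k S m p) (opp p))
  then (regions p (topAttr G S m p ∪ proj₁ (firstCall G k S m p) p) ∅ , suc (proj₂ (firstCall G k S m p)))
  else (regions p (proj₁ (secondCall G k S m p) p) (proj₁ (secondCall G k S m p) (opp p) ∪ oppAttr G k S m p)
       , suc (proj₂ (firstCall G k S m p) + proj₂ (secondCall G k S m p)))

module _ {n} (G : Game n) (k : ℕ) (S : VSet n) (m : ℕ) (p : Player) where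

  zielonka-unfold : isEmpty S ≡ false → maxPrio G S ≡ m → playerOf m ≡ p →
    zielonka G (suc k) S ≡ zielonkaStep G k S m p
  zielonka-unfold h refl refl rewrite h = refl

  zielonkaStep-won : isEmpty (proj₁ (firstCall G k S m p) (opp p)) ≡ true →
    zielonkaStep G k S m p ≡
      (regions p (topAttr G S m p ∪ proj₁ (firstCall G k S m p) p) ∅ , suc (proj₂ (firstCall G k S m p)))
  zielonkaStep-won h rewrite h = refl

  zielonkaStep-split : isEmpty (proj₁ (firstCall G k S m p) (opp p)) ≡ false →
    zielonkaStep G k S m p ≡
      (regions p (proj₁ (secondCall G k S m p) p) (proj₁ (secondCall G k S m p) (opp p) ∪ oppAttr G k S m p)
       , suc (proj₂ (firstCall G k S m p) + proj₂ (secondCall G k S m p)))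
  zielonkaStep-split h rewrite h = refl

  zielonkaStep-calls : suc (proj₂ (firstCall G k S m p)) ≤ proj₂ (zielonkaStep G k S m p)
  zielonkaStep-calls with isEmpty (proj₁ (firstCall G k S m p) (opp p))
  ... | true  = ≤-refl
  ... | false = s≤s (m≤m+n _ _)

zielonka-empty : ∀ {n} (G : Game n) k (S : VSet n) → (∀ v → S v ≡ false) →
  (∀ p v → proj₁ (zielonka G k S) p v ≡ false) × proj₂ (zielonka G k S) ≡ 1
zielonka-empty G zero    S h = (λ _ _ → refl) , refl
zielonka-empty G (suc k) S h rewrite isEmpty-true S h = (λ _ _ → refl) , refl

-- Vertex 3b + i of the ladder is the i-th of x_b, y_b, z_b; only y_b belongs to ◇.
data Kind : Set where
  kx ky kz : Kind

kindIndex : Kind → ℕ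
kindIndex kx = 0
kindIndex ky = 1
kindIndex kz = 2

index : ℕ → Kind → ℕ
index zero    k = kindIndex k
index (suc b) k = suc (suc (suc (index b k)))

locate : ℕ → ℕ × Kind
locate zero                = 0 , kx
locate (suc zero)          = 0 , ky
locate (suc (suc zero))    = 0 , kz
locate (suc (suc (suc t))) = suc (proj₁ (locate t)) , proj₂ (locate t)

locate-index : ∀ b k → locate (index b k) ≡ (b , k)
locate-index zero    kx = refl
locate-index zero    ky = refl
locate-index zero    kz = refl
locate-index (suc b) k rewrite locate-index b k = refl

index-locate : ∀ t → index (proj₁ (locate t)) (proj₂ (locate t)) ≡ t
index-locate zero                = refl
index-locate (suc zero)          = refl
index-locate (suc (suc zero))    = refl
index-locate (suc (suc (suc t))) = cong (λ s → suc (suc (suc s))) (index-locate t)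

index-kind-< : ∀ b {k k′} → kindIndex k < kindIndex k′ → index b k < index b k′
index-kind-< zero    h = h
index-kind-< (suc b) h = s≤s (s≤s (s≤s (index-kind-< b h)))

index-block-< : ∀ {b c} k k′ → b < c → index b k < index c k′
index-block-< {zero}  {suc c} k  k′ _       = ≤-trans (s≤s (bound k)) (s≤s (s≤s (s≤s z≤n)))
  where
  bound : ∀ k → kindIndex k ≤ 2
  bound kx = z≤n
  bound ky = s≤s z≤n
  bound kz = s≤s (s≤s z≤n)
index-block-< {suc b} {suc c} k k′ (s≤s h) = s≤s (s≤s (s≤s (index-block-< k k′ h)))

x<y : ∀ b → index b kx < index b ky
x<y b = index-kind-< b (s≤s z≤n)

y<z : ∀ b → index b ky < index b kz
y<z b = index-kind-< b (s≤s (s≤s z≤n))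

_==K_ : Kind → Kind → Bool
kx ==K kx = true
ky ==K ky = true
kz ==K kz = true
_  ==K _  = false

==K-sound : ∀ k k′ → (k ==K k′) ≡ true → k ≡ k′
==K-sound kx kx _ = refl
==K-sound ky ky _ = refl
==K-sound kz kz _ = refl

ladderOwner : Kind → Player
ladderOwner kx = □
ladderOwner ky = ◇
ladderOwner kz = □

ladderPrio : ℕ → Kind → ℕ
ladderPrio b kx = b + b
ladderPrio b ky = suc (b + b)
ladderPrio b kz = suc (b + b)

ladderEdge : ℕ → Kind → ℕ → Kind → Bool
ladderEdge b kx c k′ = (b ≡ᵇ c) ∧ (k′ ==K kx)
ladderEdge b ky c k′ = ((b ≡ᵇ c) ∧ (k′ ==K ky)) ∨ ((suc b ≡ᵇ c) ∧ (k′ ==K kz))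
ladderEdge b kz c k′ = (b ≡ᵇ c) ∧ (k′ ==K kx)

data LadderEdge (b : ℕ) (k : Kind) (c : ℕ) (k′ : Kind) : Set where
  x-loop : k ≡ kx → c ≡ b     → k′ ≡ kx → LadderEdge b k c k′
  y-loop : k ≡ ky → c ≡ b     → k′ ≡ ky → LadderEdge b k c k′
  y-up   : k ≡ ky → c ≡ suc b → k′ ≡ kz → LadderEdge b k c k′
  z-down : k ≡ kz → c ≡ b     → k′ ≡ kx → LadderEdge b k c k′

ladderEdge-cases : ∀ b k c k′ → ladderEdge b k c k′ ≡ true → LadderEdge b k c k′
ladderEdge-cases b kx c k′ h =
  x-loop refl (sym (≡ᵇ-true⇒≡ b c (∧-conicalˡ _ _ h))) (==K-sound k′ kx (∧-conicalʳ _ _ h))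
ladderEdge-cases b kz c k′ h =
  z-down refl (sym (≡ᵇ-true⇒≡ b c (∧-conicalˡ _ _ h))) (==K-sound k′ kx (∧-conicalʳ _ _ h))
ladderEdge-cases b ky c k′ h with ∨-true-split {(b ≡ᵇ c) ∧ (k′ ==K ky)} h
... | inj₁ h′ =
  y-loop refl (sym (≡ᵇ-true⇒≡ b c (∧-conicalˡ _ _ h′))) (==K-sound k′ ky (∧-conicalʳ _ _ h′))
... | inj₂ h′ =
  y-up refl (sym (≡ᵇ-true⇒≡ (suc b) c (∧-conicalˡ _ _ h′))) (==K-sound k′ kz (∧-conicalʳ _ _ h′))

ladderEdge-loop : ∀ b k → (k ==K kz) ≡ false → ladderEdge b k b k ≡ true
ladderEdge-loop b kx _ rewrite ≡ᵇ-refl b = refl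
ladderEdge-loop b ky _ rewrite ≡ᵇ-refl b = refl

ladderEdge-up : ∀ b → ladderEdge b ky (suc b) kz ≡ true
ladderEdge-up b rewrite ≡ᵇ-refl b = ∨-zeroʳ _

ladderEdge-down : ∀ b → ladderEdge b kz b kx ≡ true
ladderEdge-down b rewrite ≡ᵇ-refl b = refl

module _ {n : ℕ} where

  block : Fin n → ℕ
  block v = proj₁ (locate (toℕ v))

  kind : Fin n → Kind
  kind v = proj₂ (locate (toℕ v))

  toℕ-index : ∀ (v : Fin n) → toℕ v ≡ index (block v) (kind v)
  toℕ-index v = sym (index-locate (toℕ v))

  block-kind-injective : ∀ {v w : Fin n} → block v ≡ block w → kind v ≡ kind w → v ≡ w
  block-kind-injective {v} {w} eb ek =
    toℕ-injective (trans (toℕ-index v) (trans (cong₂ index eb ek) (sym (toℕ-index w))))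

  vertex : ∀ b k → index b k < n → Fin n
  vertex b k h = fromℕ< h

  locate-vertex : ∀ b k (h : index b k < n) → locate (toℕ (vertex b k h)) ≡ (b , k)
  locate-vertex b k h rewrite toℕ-fromℕ< h = locate-index b k

  block-vertex : ∀ b k (h : index b k < n) → block (vertex b k h) ≡ b
  block-vertex b k h = cong proj₁ (locate-vertex b k h)

  kind-vertex : ∀ b k (h : index b k < n) → kind (vertex b k h) ≡ k
  kind-vertex b k h = cong proj₂ (locate-vertex b k h)

  index-x-of-z : ∀ (v : Fin n) → kind v ≡ kz → index (block v) kx < n
  index-x-of-z v e =
    <-trans (index-kind-< (block v) (s≤s z≤n))
            (subst (_< n) (trans (toℕ-index v) (cong (index (block v)) e)) (toℕ<n v))

  edgeOf : Fin n → Fin n → Bool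
  edgeOf v w = ladderEdge (block v) (kind v) (block w) (kind w)

  edgeOf-vertex : ∀ (v : Fin n) {c k′} (h : index c k′ < n) →
    ladderEdge (block v) (kind v) c k′ ≡ true → edgeOf v (vertex c k′ h) ≡ true
  edgeOf-vertex v {c} {k′} h e =
    subst₂ (λ c′ k″ → ladderEdge (block v) (kind v) c′ k″ ≡ true)
           (sym (block-vertex c k′ h)) (sym (kind-vertex c k′ h)) e

  edgeOf-loop : ∀ (v : Fin n) → (kind v ==K kz) ≡ false → edgeOf v v ≡ true
  edgeOf-loop v = ladderEdge-loop (block v) (kind v)

  up : ∀ (v : Fin n) → index (suc (block v)) kz < n → Fin n
  up v = vertex (suc (block v)) kz

  edgeOf-up : ∀ (v : Fin n) → kind v ≡ ky → (h : index (suc (block v)) kz < n) → edgeOf v (up v h) ≡ true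
  edgeOf-up v e h =
    edgeOf-vertex v h
      (subst (λ k → ladderEdge (block v) k (suc (block v)) kz ≡ true) (sym e) (ladderEdge-up (block v)))

  down : ∀ (v : Fin n) → kind v ≡ kz → Fin n
  down v e = vertex (block v) kx (index-x-of-z v e)

  edgeOf-down : ∀ (v : Fin n) (e : kind v ≡ kz) → edgeOf v (down v e) ≡ true
  edgeOf-down v e =
    edgeOf-vertex v (index-x-of-z v e)
      (subst (λ k → ladderEdge (block v) k (block v) kx ≡ true) (sym e) (ladderEdge-down (block v)))

  edgeOf-total : ∀ (v : Fin n) → ∃ λ w → edgeOf v w ≡ true
  edgeOf-total v = byKind (kind v) refl
    where
    byKind : ∀ k → kind v ≡ k → ∃ λ w → edgeOf v w ≡ true
    byKind kx e = v , edgeOf-loop v (cong (_==K kz) e)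
    byKind ky e = v , edgeOf-loop v (cong (_==K kz) e)
    byKind kz e = down v e , edgeOf-down v e

ladder : (n : ℕ) → Game n
ladder n = record
  { owner = λ v → ladderOwner (kind v)
  ; edge  = edgeOf
  ; prio  = λ v → ladderPrio (block v) (kind v)
  ; total = edgeOf-total
  }

-- Every move other than a self-loop lowers this rank, so the basic cycles are the self-loops.
rank : Kind → ℕ
rank kx = 0
rank kz = 1
rank ky = 2

edgeOf-rank : ∀ {n} (v w : Fin n) → edgeOf v w ≡ true → v ≢ w → rank (kind w) < rank (kind v)
edgeOf-rank v w e v≢w with ladderEdge-cases (block v) (kind v) (block w) (kind w) e
... | x-loop ev ew ek = ⊥-elim (v≢w (block-kind-injective (sym ew) (trans ev (sym ek))))
... | y-loop ev ew ek = ⊥-elim (v≢w (block-kind-injective (sym ew) (trans ev (sym ek))))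
... | y-up   ev _  ek rewrite ev | ek = s≤s (s≤s z≤n)
... | z-down ev _  ek rewrite ev | ek = s≤s z≤n

lastOf-∈ : ∀ {n} (w : Fin n) ws → lastOf w ws ∈ (w ∷ ws)
lastOf-∈ w []       = here refl
lastOf-∈ w (u ∷ us) = there (lastOf-∈ u us)

path-rank : ∀ {n} (v w : Fin n) ws → Linked (λ a b → edgeOf a b ≡ true) (v ∷ w ∷ ws) →
  AllPairs _≢_ (v ∷ w ∷ ws) → rank (kind (lastOf w ws)) < rank (kind v)
path-rank v w []       (e ∷ _)  ((v≢w ∷ _) ∷ _)    = edgeOf-rank v w e v≢w
path-rank v w (u ∷ us) (e ∷ es) ((v≢w ∷ _) ∷ uniq) =
  <-trans (path-rank w u us es uniq) (edgeOf-rank v w e v≢w)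

basicCycle-singleton : ∀ {n} (cs : List (Fin n)) → IsBasicCycle (ladder n) cs → ∃ λ v → cs ≡ v ∷ []
basicCycle-singleton _ (v , []     , refl , _ , _ , _) = v , refl
basicCycle-singleton _ (v , w ∷ ws , refl , path , back , uniq@(v∉ ∷ _)) =
  ⊥-elim (<-asym (path-rank v w ws path uniq)
                 (edgeOf-rank (lastOf w ws) v back (λ eq → All.lookup v∉ (lastOf-∈ w ws) (sym eq))))

ladder-dull : ∀ n → Dull (ladder n)
ladder-dull n c d (c-basic , c-even) (d-basic , d-odd) v v∈c v∈d
  with basicCycle-singleton c c-basic | basicCycle-singleton d d-basic
... | _ , refl | _ , refl with v∈c | v∈d
... | here refl | here refl = true≢false (trans (sym c-even) d-odd)

-- A pattern describes a set of ladder vertices that, relative to a level i, depends only on the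
-- kind of a vertex and on the zone of its block b: lo (b < i-1), prev (b = i-1), cur (b = i),
-- next (b = i+1) or hi (b > i+1).
data Zone : Set where
  lo prev cur next hi : Zone

zone : ℕ → ℕ → Zone
zone zero    zero          = cur
zone zero    (suc zero)    = prev
zone zero    (suc (suc _)) = lo
zone (suc b) zero          = nextOrHi b
  where
  nextOrHi : ℕ → Zone
  nextOrHi zero    = next
  nextOrHi (suc _) = hi
zone (suc b) (suc i)       = zone b i

above : Zone → Zone
above lo   = lo
above prev = cur
above cur  = next
above next = hi
above hi   = hi

zone-suc : ∀ b i → zone (suc b) i ≡ above (zone b i) ⊎ (zone b i ≡ lo × zone (suc b) i ≡ prev)
zone-suc zero    zero                = inj₁ refl
zone-suc zero    (suc zero)          = inj₁ refl
zone-suc zero    (suc (suc zero))    = inj₂ (refl , refl)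
zone-suc zero    (suc (suc (suc _))) = inj₁ refl
zone-suc (suc zero)    zero          = inj₁ refl
zone-suc (suc (suc _)) zero          = inj₁ refl
zone-suc (suc b) (suc i)             = zone-suc b i

zone-self : ∀ i → zone i i ≡ cur
zone-self zero    = refl
zone-self (suc i) = zone-self i

zone-next : ∀ i → zone (suc i) i ≡ next
zone-next zero    = refl
zone-next (suc i) = zone-next i

isCur isNext : Zone → Bool
isCur cur = true
isCur _   = false
isNext next = true
isNext _    = false

isCur-zone : ∀ b i → (b ≡ᵇ i) ≡ isCur (zone b i)
isCur-zone zero          zero          = refl
isCur-zone zero          (suc zero)    = refl
isCur-zone zero          (suc (suc _)) = refl
isCur-zone (suc zero)    zero          = refl
isCur-zone (suc (suc _)) zero          = refl
isCur-zone (suc b)       (suc i)       = isCur-zone b i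

isNext-zone : ∀ b i → (b ≡ᵇ suc i) ≡ isNext (zone b i)
isNext-zone zero          zero          = refl
isNext-zone zero          (suc zero)    = refl
isNext-zone zero          (suc (suc _)) = refl
isNext-zone (suc zero)    zero          = refl
isNext-zone (suc (suc _)) zero          = refl
isNext-zone (suc b)       (suc i)       = isNext-zone b i

zone≡cur⇒≡ : ∀ b i → zone b i ≡ cur → b ≡ i
zone≡cur⇒≡ b i h = ≡ᵇ-true⇒≡ b i (trans (isCur-zone b i) (cong isCur h))

zone≡next⇒≡suc : ∀ b i → zone b i ≡ next → b ≡ suc i
zone≡next⇒≡suc b i h = ≡ᵇ-true⇒≡ b (suc i) (trans (isNext-zone b i) (cong isNext h))

zone≡lo⊎prev⇒< : ∀ b i → zone b i ≡ lo ⊎ zone b i ≡ prev → b < i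
zone≡lo⊎prev⇒< zero          (suc _) _   = s≤s z≤n
zone≡lo⊎prev⇒< zero          zero    (inj₁ ())
zone≡lo⊎prev⇒< zero          zero    (inj₂ ())
zone≡lo⊎prev⇒< (suc zero)    zero    (inj₁ ())
zone≡lo⊎prev⇒< (suc zero)    zero    (inj₂ ())
zone≡lo⊎prev⇒< (suc (suc _)) zero    (inj₁ ())
zone≡lo⊎prev⇒< (suc (suc _)) zero    (inj₂ ())
zone≡lo⊎prev⇒< (suc b)       (suc i) h = s≤s (zone≡lo⊎prev⇒< b i h)

<⇒zone≡lo⊎prev : ∀ b i → b < i → zone b i ≡ lo ⊎ zone b i ≡ prev
<⇒zone≡lo⊎prev zero    (suc zero)    _       = inj₂ refl
<⇒zone≡lo⊎prev zero    (suc (suc _)) _       = inj₁ refl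
<⇒zone≡lo⊎prev (suc b) (suc i)       (s≤s h) = <⇒zone≡lo⊎prev b i h

Pattern : Set
Pattern = Zone → Kind → Bool

region : ∀ {n} → ℕ → Pattern → VSet n
region i T v = T (zone (block v) i) (kind v)

region-vertex : ∀ {n} i (T : Pattern) c k (h : index c k < n) → region i T (vertex c k h) ≡ T (zone c i) k
region-vertex i T c k h = cong₂ (λ b k′ → T (zone b i) k′) (block-vertex c k h) (kind-vertex c k h)

_∩ᴾ_ _∪ᴾ_ _∖ᴾ_ : Pattern → Pattern → Pattern
(A ∩ᴾ B) r k = A r k ∧ B r k
(A ∪ᴾ B) r k = A r k ∨ B r k
(A ∖ᴾ B) r k = A r k ∧ not (B r k)





∩-region : ∀ {n} i {S X : VSet n} A B → S ≗ region i A → X ≗ region i B →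
  (S ∩ X) ≗ region i (A ∩ᴾ B)
∩-region i A B S≗ X≗ v = cong₂ _∧_ (S≗ v) (X≗ v)

-- The block above a lo block can be prev, and z-vertices are the only ones entered from the
-- block below, so a pattern must not tell lo and prev apart on them.
Coherent : Pattern → Set
Coherent T = T lo kz ≡ T prev kz

coherent-above : ∀ T → Coherent T → ∀ b i → T (zone (suc b) i) kz ≡ T (above (zone b i)) kz
coherent-above T coh b i with zone-suc b i
... | inj₁ e = cong (λ r → T r kz) e
... | inj₂ (e , e′) rewrite e | e′ = sym coh

ZInRange : ℕ → Pattern → ℕ → Set
ZInRange i T n = ∀ b → T (zone (suc b) i) kz ≡ true → index (suc b) kz < n

-- Whether some move from a vertex of kind k in zone r enters a vertex in T.
someMove : Pattern → Zone → Kind → Bool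
someMove T r kx = T r kx
someMove T r ky = T r ky ∨ T (above r) kz
someMove T r kz = T r kx

module Moves {n} (i : ℕ) (Q : Pattern) (coh : Coherent Q) (inRange : ZInRange i Q n) where

  movesInto : Fin n → Bool
  movesInto v = any (λ w → edgeOf v w ∧ region i Q w) (allFin n)

  target-in-Q : ∀ (v w : Fin n) {c k} → (edgeOf v w ∧ region i Q w) ≡ true → block w ≡ c → kind w ≡ k →
    Q (zone c i) k ≡ true
  target-in-Q v w h eb ek = subst₂ (λ c k → Q (zone c i) k ≡ true) eb ek (∧-conicalʳ (edgeOf v w) _ h)

  ofKind : ∀ (v : Fin n) {k} → kind v ≡ k → someMove Q (zone (block v) i) k ≡ true →
    someMove Q (zone (block v) i) (kind v) ≡ true
  ofKind v refl h = h

  someMove-sound : ∀ (v : Fin n) → movesInto v ≡ true → someMove Q (zone (block v) i) (kind v) ≡ true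
  someMove-sound v h with any-witness _ (allFin n) h
  ... | w , hw with ladderEdge-cases (block v) (kind v) (block w) (kind w) (∧-conicalˡ _ _ hw)
  ... | x-loop ev eb ek = ofKind v ev (target-in-Q v w hw eb ek)
  ... | y-loop ev eb ek = ofKind v ev (∨-trueˡ _ (target-in-Q v w hw eb ek))
  ... | y-up   ev eb ek =
    ofKind v ev (∨-trueʳ _ (trans (sym (coherent-above Q coh (block v) i)) (target-in-Q v w hw eb ek)))
  ... | z-down ev eb ek = ofKind v ev (target-in-Q v w hw eb ek)

  someMove-complete : ∀ (v : Fin n) → someMove Q (zone (block v) i) (kind v) ≡ true → movesInto v ≡ true
  someMove-complete v = byKind (kind v) refl
    where
    r = zone (block v) i
    move : ∀ w → edgeOf v w ≡ true → region i Q w ≡ true → movesInto v ≡ true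
    move w e q = any-∈ _ (∈-allFin w) (∧-true e q)
    loop : ∀ {k} → kind v ≡ k → (k ==K kz) ≡ false → Q r k ≡ true → movesInto v ≡ true
    loop refl notZ q = move v (edgeOf-loop v notZ) q
    byKind : ∀ k → kind v ≡ k → someMove Q r k ≡ true → movesInto v ≡ true
    byKind kx e q = loop e refl q
    byKind ky e q with ∨-true-split {Q r ky} q
    ... | inj₁ q′ = loop e refl q′
    ... | inj₂ q′ = move (up v h) (edgeOf-up v e h) (trans (region-vertex i Q (suc (block v)) kz h) Q-z)
      where
      Q-z = trans (coherent-above Q coh (block v) i) q′
      h = inRange (block v) Q-z
    byKind kz e q = move (down v e) (edgeOf-down v e) (trans (region-vertex i Q (block v) kx (index-x-of-z v e)) q)

  movesInto-someMove : ∀ (v : Fin n) → movesInto v ≡ someMove Q (zone (block v) i) (kind v)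
  movesInto-someMove v = bool-ext (someMove-sound v) (someMove-complete v)

attrStepᴾ : Pattern → Player → Pattern → Pattern
attrStepᴾ S p X r k =
  X r k ∨ (S r k ∧ (if ladderOwner k ==P p then someMove (S ∩ᴾ X) r k else not (someMove (S ∖ᴾ X) r k)))

module _ {n} (i : ℕ) {S X : VSet n} (TS TX : Pattern) (S≗ : S ≗ region i TS) (X≗ : X ≗ region i TX)
         (cohS : Coherent TS) (cohX : Coherent TX) (inRange : ZInRange i TS n) where

  attrStep-region : ∀ p → attrStep (ladder n) S p X ≗ region i (attrStepᴾ TS p TX)
  attrStep-region p v =
    cong₂ _∨_ (X≗ v)
      (cong₂ _∧_ (S≗ v) (cong₂ (λ a b → if ladderOwner (kind v) ==P p then a else b) anyEq allEq))
    where
    r = zone (block v) i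
    inside : ∀ w → (S w ∧ edgeOf v w ∧ X w) ≡ (edgeOf v w ∧ region i (TS ∩ᴾ TX) w)
    inside w = trans (cong₂ (λ a c → a ∧ edgeOf v w ∧ c) (S≗ w) (X≗ w))
                     (∧-swapˡ (region i TS w) (edgeOf v w) (region i TX w))
    escapes : ∀ w → not (not (S w ∧ edgeOf v w) ∨ X w) ≡ (edgeOf v w ∧ region i (TS ∖ᴾ TX) w)
    escapes w = trans (cong₂ (λ a c → not (not (a ∧ edgeOf v w) ∨ c)) (S≗ w) (X≗ w))
                      (not-guarded (region i TS w) (edgeOf v w) (region i TX w))
    anyEq : any (λ w → S w ∧ edgeOf v w ∧ X w) (allFin n) ≡ someMove (TS ∩ᴾ TX) r (kind v)
    anyEq = trans (any-cong inside (allFin n))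
                  (Moves.movesInto-someMove i (TS ∩ᴾ TX) (cong₂ _∧_ cohS cohX)
                                            (λ b h → inRange b (∧-conicalˡ _ _ h)) v)
    allEq : all (λ w → not (S w ∧ edgeOf v w) ∨ X w) (allFin n) ≡ not (someMove (TS ∖ᴾ TX) r (kind v))
    allEq = trans (all≡not-any-not _ (allFin n))
                  (cong not (trans (any-cong escapes (allFin n))
                                   (Moves.movesInto-someMove i (TS ∖ᴾ TX)
                                      (cong₂ (λ a c → a ∧ not c) cohS cohX)
                                      (λ b h → inRange b (∧-conicalˡ _ _ h)) v)))

everywhere : (Zone → Kind → Bool) → Bool
everywhere f =
  all (uncurry f) (cartesianProduct (lo ∷ prev ∷ cur ∷ next ∷ hi ∷ []) (kx ∷ ky ∷ kz ∷ []))

everywhere-sound : ∀ f → everywhere f ≡ true → ∀ r k → f r k ≡ true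
everywhere-sound f h r k = all-∈ (uncurry f) (∈-cartesianProduct⁺ (∈-zones r) (∈-kinds k)) h
  where
  ∈-zones : ∀ r → r ∈ lo ∷ prev ∷ cur ∷ next ∷ hi ∷ []
  ∈-zones lo   = here refl
  ∈-zones prev = there (here refl)
  ∈-zones cur  = there (there (here refl))
  ∈-zones next = there (there (there (here refl)))
  ∈-zones hi   = there (there (there (there (here refl))))
  ∈-kinds : ∀ k → k ∈ kx ∷ ky ∷ kz ∷ []
  ∈-kinds kx = here refl
  ∈-kinds ky = there (here refl)
  ∈-kinds kz = there (there (here refl))

_==B_ : Bool → Bool → Bool
a ==B b = if a then b else not b

==B-sound : ∀ a b → (a ==B b) ≡ true → a ≡ b
==B-sound true  true  _ = refl
==B-sound false false _ = refl

_≐_ : Pattern → Pattern → Bool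
A ≐ B = everywhere (λ r k → A r k ==B B r k)

nowhere : Pattern → Bool
nowhere T = everywhere (λ r k → not (T r k))

region-≐ : ∀ {n} i A B → (A ≐ B) ≡ true → region {n} i A ≗ region i B
region-≐ i A B h v = ==B-sound _ _ (everywhere-sound (λ r k → A r k ==B B r k) h _ (kind v))

recast : ∀ {n} i A B {X : VSet n} → X ≗ region i A → (A ≐ B) ≡ true → X ≗ region i B
recast i A B X≗ e = ≗-trans X≗ (region-≐ i A B e)

∖-region≐ : ∀ {n} i {S X : VSet n} A B C → S ≗ region i A → X ≗ region i B → ((A ∖ᴾ B) ≐ C) ≡ true →
  (S ∖ X) ≗ region i C
∖-region≐ i A B C S≗ X≗ = recast i (A ∖ᴾ B) C (λ v → cong₂ (λ a b → a ∧ not b) (S≗ v) (X≗ v))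

∪-region≐ : ∀ {n} i {S X : VSet n} A B C → S ≗ region i A → X ≗ region i B → ((A ∪ᴾ B) ≐ C) ≡ true →
  (S ∪ X) ≗ region i C
∪-region≐ i A B C S≗ X≗ = recast i (A ∪ᴾ B) C (λ v → cong₂ _∨_ (S≗ v) (X≗ v))

region-nowhere : ∀ {n} i T → nowhere T ≡ true → ∀ (v : Fin n) → region i T v ≡ false
region-nowhere i T h v = not-true (everywhere-sound (λ r k → not (T r k)) h _ (kind v))

samePrio : Kind → Kind → Bool
samePrio kx kx = true
samePrio kx _  = false
samePrio _  kx = false
samePrio _  _  = true

double-≡ᵇ : ∀ b c → ((b + b) ≡ᵇ (c + c)) ≡ (b ≡ᵇ c)
double-≡ᵇ zero    zero    = refl
double-≡ᵇ zero    (suc c) = refl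
double-≡ᵇ (suc b) zero    = refl
double-≡ᵇ (suc b) (suc c) rewrite +-suc b b | +-suc c c = double-≡ᵇ b c

odd≢ᵇdouble : ∀ b c → (suc (b + b) ≡ᵇ (c + c)) ≡ false
odd≢ᵇdouble zero    zero          = refl
odd≢ᵇdouble zero    (suc zero)    = refl
odd≢ᵇdouble zero    (suc (suc c)) = refl
odd≢ᵇdouble (suc b) zero          = refl
odd≢ᵇdouble (suc b) (suc c) rewrite +-suc b b | +-suc c c = odd≢ᵇdouble b c

double≢ᵇodd : ∀ b c → ((b + b) ≡ᵇ suc (c + c)) ≡ false
double≢ᵇodd zero          zero    = refl
double≢ᵇodd zero          (suc c) = refl
double≢ᵇodd (suc zero)    zero    = refl
double≢ᵇodd (suc (suc b)) zero    = refl
double≢ᵇodd (suc b) (suc c) rewrite +-suc b b | +-suc c c = double≢ᵇodd b c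

ladderPrio-≡ᵇ : ∀ b k c k′ → (ladderPrio b k ≡ᵇ ladderPrio c k′) ≡ ((b ≡ᵇ c) ∧ samePrio k k′)
ladderPrio-≡ᵇ b kx c kx rewrite double-≡ᵇ b c  | ∧-identityʳ (b ≡ᵇ c) = refl
ladderPrio-≡ᵇ b kx c ky rewrite double≢ᵇodd b c | ∧-zeroʳ (b ≡ᵇ c) = refl
ladderPrio-≡ᵇ b kx c kz rewrite double≢ᵇodd b c | ∧-zeroʳ (b ≡ᵇ c) = refl
ladderPrio-≡ᵇ b ky c kx rewrite odd≢ᵇdouble b c | ∧-zeroʳ (b ≡ᵇ c) = refl
ladderPrio-≡ᵇ b ky c ky rewrite double-≡ᵇ b c  | ∧-identityʳ (b ≡ᵇ c) = refl
ladderPrio-≡ᵇ b ky c kz rewrite double-≡ᵇ b c  | ∧-identityʳ (b ≡ᵇ c) = refl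
ladderPrio-≡ᵇ b kz c kx rewrite odd≢ᵇdouble b c | ∧-zeroʳ (b ≡ᵇ c) = refl
ladderPrio-≡ᵇ b kz c ky rewrite double-≡ᵇ b c  | ∧-identityʳ (b ≡ᵇ c) = refl
ladderPrio-≡ᵇ b kz c kz rewrite double-≡ᵇ b c  | ∧-identityʳ (b ≡ᵇ c) = refl

isEven-double : ∀ b → isEven (b + b) ≡ true
isEven-double zero    = refl
isEven-double (suc b) rewrite +-suc b b | isEven-double b = refl

playerOf-x : ∀ b → playerOf (ladderPrio b kx) ≡ ◇
playerOf-x b rewrite isEven-double b = refl

playerOf-y : ∀ b → playerOf (ladderPrio b ky) ≡ □
playerOf-y b rewrite isEven-double b = refl

playerOf-z : ∀ b → playerOf (ladderPrio b kz) ≡ □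
playerOf-z b rewrite isEven-double b = refl

topAtCur topAtNext : Pattern → Kind → Pattern
topAtCur  T k′ r k = (T r k ∧ (isCur r  ∧ samePrio k k′)) ∧ T r k
topAtNext T k′ r k = (T r k ∧ (isNext r ∧ samePrio k k′)) ∧ T r k

topSet-cur : ∀ {n} i T {S : VSet n} → S ≗ region i T → ∀ k′ →
  (topSet (ladder n) S (ladderPrio i k′) ∩ S) ≗ region i (topAtCur T k′)
topSet-cur i T S≗ k′ v
  rewrite ladderPrio-≡ᵇ (block v) (kind v) i k′ | isCur-zone (block v) i | S≗ v = refl

topSet-next : ∀ {n} i T {S : VSet n} → S ≗ region i T → ∀ k′ →
  (topSet (ladder n) S (ladderPrio (suc i) k′) ∩ S) ≗ region i (topAtNext T k′)
topSet-next i T S≗ k′ v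
  rewrite ladderPrio-≡ᵇ (block v) (kind v) (suc i) k′ | isNext-zone (block v) i | S≗ v = refl

module Attractor {n} (i : ℕ) (TS : Pattern) {S : VSet n} (S≗ : S ≗ region i TS) (cohS : Coherent TS)
                 (inRange : ZInRange i TS n) (p : Player) where

  step : ∀ {X} T → X ≗ region i T → Coherent T → attrStep (ladder n) S p X ≗ region i (attrStepᴾ TS p T)
  step T X≗ cohT = attrStep-region i TS T S≗ X≗ cohS cohT inRange p

  iterate-fixpoint : ∀ {X} T → X ≗ region i T → Coherent T → (attrStepᴾ TS p T ≐ T) ≡ true →
    ∀ k → iterate k (attrStep (ladder n) S p) X ≗ region i T
  iterate-fixpoint T X≗ cohT fix zero    = X≗
  iterate-fixpoint T X≗ cohT fix (suc k) =
    recast i (attrStepᴾ TS p T) T (step T (iterate-fixpoint T X≗ cohT fix k) cohT) fix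

  iterate-twoSteps : ∀ {X} T₀ T₁ T₂ → X ≗ region i T₀ → Coherent T₀ → Coherent T₁ → Coherent T₂ →
    (attrStepᴾ TS p T₀ ≐ T₁) ≡ true → (attrStepᴾ TS p T₁ ≐ T₂) ≡ true → (attrStepᴾ TS p T₂ ≐ T₂) ≡ true →
    ∀ k → 2 ≤ k → iterate k (attrStep (ladder n) S p) X ≗ region i T₂
  iterate-twoSteps {X} T₀ T₁ T₂ X≗ coh₀ coh₁ coh₂ e₀ e₁ e₂ (suc (suc k)) (s≤s (s≤s _)) v =
    trans (cong (λ Y → Y v) (trans (iterate-suc f (suc k) X) (iterate-suc f k (f X))))
          (iterate-fixpoint T₂ two coh₂ e₂ k v)
    where
    f = attrStep (ladder n) S p
    two : f (f X) ≗ region i T₂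
    two = recast i (attrStepᴾ TS p T₁) T₂ (step T₁ one coh₁) e₁
      where one = recast i (attrStepᴾ TS p T₀) T₁ (step T₀ X≗ coh₀) e₀

  attr-topAtCur : ∀ k′ T → (topAtCur TS k′ ≐ T) ≡ true → Coherent T → (attrStepᴾ TS p T ≐ T) ≡ true →
    topAttr (ladder n) S (ladderPrio i k′) p ≗ region i T
  attr-topAtCur k′ T e cohT fix =
    iterate-fixpoint T (recast i (topAtCur TS k′) T (topSet-cur i TS S≗ k′) e) cohT fix n

  attr-topAtNext : ∀ k′ T → (topAtNext TS k′ ≐ T) ≡ true → Coherent T → (attrStepᴾ TS p T ≐ T) ≡ true →
    topAttr (ladder n) S (ladderPrio (suc i) k′) p ≗ region i T
  attr-topAtNext k′ T e cohT fix =
    iterate-fixpoint T (recast i (topAtNext TS k′) T (topSet-next i TS S≗ k′) e) cohT fix n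

_≤K_ : Kind → Kind → Bool
kx ≤K _  = true
_  ≤K kx = false
_  ≤K _  = true

atMostCur atMostNext : Kind → Zone → Kind → Bool
atMostCur k′ lo   _ = true
atMostCur k′ prev _ = true
atMostCur k′ cur  k = k ≤K k′
atMostCur k′ next _ = false
atMostCur k′ hi   _ = false
atMostNext k′ next k = k ≤K k′
atMostNext k′ hi   _ = false
atMostNext k′ _    _ = true

within : (Zone → Kind → Bool) → Pattern → Bool
within ok T = everywhere (λ r k → not (T r k) ∨ ok r k)

within-sound : ∀ ok T → within ok T ≡ true → ∀ r k → T r k ≡ true → ok r k ≡ true
within-sound ok T h r k t =
  subst (λ a → not a ∨ ok r k ≡ true) t (everywhere-sound (λ r k → not (T r k) ∨ ok r k) h r k)

ladderPrio-mono-block : ∀ {b c} k k′ → b < c → ladderPrio b k ≤ ladderPrio c k′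
ladderPrio-mono-block {b} {c} k k′ b<c = ≤-trans (atMostOdd k) (≤-trans (odd<double b<c) (double≤ k′))
  where
  atMostOdd : ∀ k → ladderPrio b k ≤ suc (b + b)
  atMostOdd kx = n≤1+n _
  atMostOdd ky = ≤-refl
  atMostOdd kz = ≤-refl
  odd<double : ∀ {b c} → b < c → suc (b + b) ≤ c + c
  odd<double {b} {suc c} (s≤s h) rewrite +-suc c c = s≤s (≤-trans (n≤1+n _) (s≤s (+-mono-≤ h h)))
  double≤ : ∀ k → c + c ≤ ladderPrio c k
  double≤ kx = ≤-refl
  double≤ ky = n≤1+n _
  double≤ kz = n≤1+n _

ladderPrio-mono-kind : ∀ b {k k′} → (k ≤K k′) ≡ true → ladderPrio b k ≤ ladderPrio b k′
ladderPrio-mono-kind b {kx} {kx} _ = ≤-refl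
ladderPrio-mono-kind b {kx} {ky} _ = n≤1+n _
ladderPrio-mono-kind b {kx} {kz} _ = n≤1+n _
ladderPrio-mono-kind b {ky} {ky} _ = ≤-refl
ladderPrio-mono-kind b {ky} {kz} _ = ≤-refl
ladderPrio-mono-kind b {kz} {ky} _ = ≤-refl
ladderPrio-mono-kind b {kz} {kz} _ = ≤-refl

ladderPrio-atMostCur : ∀ i T k′ → within (atMostCur k′) T ≡ true →
  ∀ b k → T (zone b i) k ≡ true → ladderPrio b k ≤ ladderPrio i k′
ladderPrio-atMostCur i T k′ h b k t with zone b i in e | within-sound (atMostCur k′) T h (zone b i) k t
... | lo   | _  = ladderPrio-mono-block k k′ (zone≡lo⊎prev⇒< b i (inj₁ e))
... | prev | _  = ladderPrio-mono-block k k′ (zone≡lo⊎prev⇒< b i (inj₂ e))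
... | cur  | ok rewrite zone≡cur⇒≡ b i e = ladderPrio-mono-kind i ok

ladderPrio-atMostNext : ∀ i T k′ → within (atMostNext k′) T ≡ true →
  ∀ b k → T (zone b i) k ≡ true → ladderPrio b k ≤ ladderPrio (suc i) k′
ladderPrio-atMostNext i T k′ h b k t with zone b i in e | within-sound (atMostNext k′) T h (zone b i) k t
... | lo   | _  = ladderPrio-mono-block k k′ (<-trans (zone≡lo⊎prev⇒< b i (inj₁ e)) (n<1+n i))
... | prev | _  = ladderPrio-mono-block k k′ (<-trans (zone≡lo⊎prev⇒< b i (inj₂ e)) (n<1+n i))
... | cur  | _  rewrite zone≡cur⇒≡ b i e = ladderPrio-mono-block k k′ (n<1+n i)
... | next | ok rewrite zone≡next⇒≡suc b i e = ladderPrio-mono-kind (suc i) ok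

isEmpty-region : ∀ {n} i T {S : VSet n} → S ≗ region i T → nowhere T ≡ true → isEmpty S ≡ true
isEmpty-region i T S≗ none = isEmpty-true _ (λ v → trans (S≗ v) (region-nowhere i T none v))

module _ {n} (i : ℕ) (T : Pattern) {S : VSet n} (S≗ : S ≗ region i T) (k : ℕ) {p : Player} where

  zielonka-unfold-region : ∀ c k′ (h : index c k′ < n) → T (zone c i) k′ ≡ true →
    (∀ b k → T (zone b i) k ≡ true → ladderPrio b k ≤ ladderPrio c k′) →
    playerOf (ladderPrio c k′) ≡ p →
    zielonka (ladder n) (suc k) S ≡ zielonkaStep (ladder n) k S (ladderPrio c k′) p
  zielonka-unfold-region c k′ h t bound player =
    zielonka-unfold (ladder n) k S _ p (isEmpty-false S (vertex c k′ h) S-top) maxPrio-top player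
    where
    S-top : S (vertex c k′ h) ≡ true
    S-top = trans (S≗ _) (trans (region-vertex i T c k′ h) t)
    maxPrio-top : maxPrio (ladder n) S ≡ ladderPrio c k′
    maxPrio-top = maxPrio-attained (ladder n) S _ (vertex c k′ h) S-top
                    (cong₂ ladderPrio (block-vertex c k′ h) (kind-vertex c k′ h))
                    (λ w Sw → bound (block w) (kind w) (trans (sym (S≗ w)) Sw))

  zielonka-unfold-cur : ∀ k′ → index i k′ < n → T cur k′ ≡ true → within (atMostCur k′) T ≡ true →
    playerOf (ladderPrio i k′) ≡ p →
    zielonka (ladder n) (suc k) S ≡ zielonkaStep (ladder n) k S (ladderPrio i k′) p
  zielonka-unfold-cur k′ h t bounded =
    zielonka-unfold-region i k′ h (subst (λ r → T r k′ ≡ true) (sym (zone-self i)) t)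
                           (ladderPrio-atMostCur i T k′ bounded)

  zielonka-unfold-next : ∀ k′ → index (suc i) k′ < n → T next k′ ≡ true → within (atMostNext k′) T ≡ true →
    playerOf (ladderPrio (suc i) k′) ≡ p →
    zielonka (ladder n) (suc k) S ≡ zielonkaStep (ladder n) k S (ladderPrio (suc i) k′) p
  zielonka-unfold-next k′ h t bounded =
    zielonka-unfold-region (suc i) k′ h (subst (λ r → T r k′ ≡ true) (sym (zone-next i)) t)
                           (ladderPrio-atMostNext i T k′ bounded)

zInRange-cur : ∀ {n} i T → T next kz ≡ false → T hi kz ≡ false → index i kz < n → ZInRange i T n
zInRange-cur i T notNext notHi h b t with zone (suc b) i in e
... | lo   = <-trans (index-block-< kz kz (zone≡lo⊎prev⇒< (suc b) i (inj₁ e))) h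
... | prev = <-trans (index-block-< kz kz (zone≡lo⊎prev⇒< (suc b) i (inj₂ e))) h
... | cur  = subst (λ c → index c kz < _) (sym (zone≡cur⇒≡ (suc b) i e)) h
... | next = ⊥-elim (true≢false (trans (sym t) notNext))
... | hi   = ⊥-elim (true≢false (trans (sym t) notHi))

zInRange-prev : ∀ {n} i T → T cur kz ≡ false → T next kz ≡ false → T hi kz ≡ false → index i kx < n →
  ZInRange i T n
zInRange-prev i T notCur notNext notHi h b t with zone (suc b) i in e
... | lo   = <-trans (index-block-< kz kx (zone≡lo⊎prev⇒< (suc b) i (inj₁ e))) h
... | prev = <-trans (index-block-< kz kx (zone≡lo⊎prev⇒< (suc b) i (inj₂ e))) h
... | cur  = ⊥-elim (true≢false (trans (sym t) notCur))
... | next = ⊥-elim (true≢false (trans (sym t) notNext))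
... | hi   = ⊥-elim (true≢false (trans (sym t) notHi))

region-empty : ∀ {n} i T {X : VSet n} → X ≗ region i T → nowhere T ≡ true → ∀ v → X v ≡ false
region-empty i T X≗ none v = trans (X≗ v) (region-nowhere i T none v)

-- At level 0 no block lies in zone lo or prev.
forgetBelow : Pattern → Pattern
forgetBelow T lo   _ = false
forgetBelow T prev _ = false
forgetBelow T r    k = T r k

forgetBelow-level0 : ∀ T b k → T (zone b 0) k ≡ forgetBelow T (zone b 0) k
forgetBelow-level0 T zero          k = refl
forgetBelow-level0 T (suc zero)    k = refl
forgetBelow-level0 T (suc (suc _)) k = refl

region-≐-level0 : ∀ {n} A B → (forgetBelow A ≐ forgetBelow B) ≡ true → region {n} 0 A ≗ region 0 B
region-≐-level0 A B h v =
  trans (forgetBelow-level0 A (block v) (kind v))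
        (trans (region-≐ 0 (forgetBelow A) (forgetBelow B) h v) (sym (forgetBelow-level0 B (block v) (kind v))))

region-empty-level0 : ∀ {n} T {X : VSet n} → X ≗ region 0 T → nowhere (forgetBelow T) ≡ true →
  ∀ v → X v ≡ false
region-empty-level0 T X≗ none v =
  trans (X≗ v) (trans (forgetBelow-level0 T (block v) (kind v)) (region-nowhere 0 (forgetBelow T) none v))

kinds : Bool → Bool → Bool → Kind → Bool
kinds a _ _ kx = a
kinds _ b _ ky = b
kinds _ _ c kz = c

xyz ∅ₖ xₖ yₖ zₖ xzₖ yzₖ : Kind → Bool
xyz = kinds true  true  true
∅ₖ  = kinds false false false
xₖ  = kinds true  false false
yₖ  = kinds false true  false
zₖ  = kinds false false true
xzₖ = kinds true  false true
yzₖ = kinds false true  true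

byZone : (Kind → Bool) → (Kind → Bool) → (Kind → Bool) → (Kind → Bool) → (Kind → Bool) → Pattern
byZone l _ _ _ _ lo   = l
byZone _ p _ _ _ prev = p
byZone _ _ c _ _ cur  = c
byZone _ _ _ n _ next = n
byZone _ _ _ _ h hi   = h

prefix : Kind → Pattern
prefix k′ = byZone xyz xyz (λ k → kindIndex k ≤ᵇ kindIndex k′) ∅ₖ ∅ₖ

emptyᴾ upToX upToY upToZ upToNextX upToZ∖y upToNextX∖y onlyY upToX∖prevY onlyPrevY : Pattern
emptyᴾ      = byZone ∅ₖ  ∅ₖ  ∅ₖ  ∅ₖ ∅ₖ
upToX       = prefix kx
upToY       = prefix ky
upToZ       = prefix kz
upToNextX   = byZone xyz xyz xyz xₖ ∅ₖ
upToZ∖y     = byZone xyz xyz xzₖ ∅ₖ ∅ₖ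
upToNextX∖y = byZone xyz xyz xzₖ xₖ ∅ₖ
onlyY       = byZone ∅ₖ  ∅ₖ  yₖ  ∅ₖ ∅ₖ
upToX∖prevY = byZone xyz xzₖ xₖ  ∅ₖ ∅ₖ
onlyPrevY   = byZone ∅ₖ  yₖ  ∅ₖ  ∅ₖ ∅ₖ

isEmpty-cur : ∀ {n} i T {X : VSet n} k′ → X ≗ region i T → index i k′ < n → T cur k′ ≡ true →
  isEmpty X ≡ false
isEmpty-cur i T k′ X≗ h t =
  isEmpty-false _ (vertex i k′ h)
    (trans (X≗ _) (trans (region-vertex i T i k′ h) (subst (λ r → T r k′ ≡ true) (sym (zone-self i)) t)))

2≤index-z : ∀ b → 2 ≤ index b kz
2≤index-z zero    = ≤-refl
2≤index-z (suc b) = s≤s (s≤s z≤n)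

-- Level i+1 seen from level i: the zones lo and prev merge into lo, and next and hi into hi.
shiftᴾ : Pattern → Pattern
shiftᴾ T lo   = T lo
shiftᴾ T prev = T lo
shiftᴾ T cur  = T prev
shiftᴾ T next = T cur
shiftᴾ T hi   = T hi

shiftᴾ-zone : ∀ (T : Pattern) b i k → T next k ≡ T hi k → T (zone b (suc i)) k ≡ shiftᴾ T (zone b i) k
shiftᴾ-zone T zero                zero          k _ = refl
shiftᴾ-zone T zero                (suc zero)    k _ = refl
shiftᴾ-zone T zero                (suc (suc i)) k _ = refl
shiftᴾ-zone T (suc zero)          zero          k _ = refl
shiftᴾ-zone T (suc (suc zero))    zero          k h = h
shiftᴾ-zone T (suc (suc (suc b))) zero          k _ = refl
shiftᴾ-zone T (suc b)             (suc i)       k h = shiftᴾ-zone T b i k h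

region-shiftᴾ : ∀ {n} i T T′ → (∀ k → T next k ≡ T hi k) → (shiftᴾ T ≐ T′) ≡ true →
  region {n} (suc i) T ≗ region i T′
region-shiftᴾ i T T′ h e v =
  trans (shiftᴾ-zone T (block v) i (kind v) (h (kind v))) (region-≐ i (shiftᴾ T) T′ e v)

record Yields {n} (i : ℕ) (W◇ W□ : Pattern) (c : ℕ) (r : Result n) : Set where
  constructor yields
  field
    won◇  : proj₁ r ◇ ≗ region i W◇
    won□  : proj₁ r □ ≗ region i W□
    calls : c ≤ proj₂ r
open Yields

onlyY-run : ∀ i {n} k {S : VSet n} → 1 ≤ k → index i kz < n → S ≗ region i onlyY →
  Yields i emptyᴾ onlyY 1 (zielonka (ladder n) k S)
onlyY-run i {n} (suc k) {S} _ hz S≗ =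
  subst (Yields i emptyᴾ onlyY 1) (sym (trans unfold (zielonkaStep-won G k S m □ opp-empty)))
        (yields (λ v → sym (region-nowhere i emptyᴾ refl v)) won□′ (s≤s z≤n))
  where
  G = ladder n
  m = ladderPrio i ky
  unfold = zielonka-unfold-cur i onlyY S≗ k ky (<-trans (y<z i) hz) refl refl (playerOf-y i)
  A≗ = Attractor.attr-topAtCur i onlyY S≗ refl (zInRange-cur i onlyY refl refl hz) □ ky onlyY refl refl refl
  first = zielonka-empty G k (S ∖ topAttr G S m □)
            (region-empty i emptyᴾ (∖-region≐ i onlyY onlyY emptyᴾ S≗ A≗ refl) refl)
  opp-empty : isEmpty (proj₁ (firstCall G k S m □) ◇) ≡ true
  opp-empty = isEmpty-true _ (proj₁ first ◇)
  won□′ : (topAttr G S m □ ∪ proj₁ (firstCall G k S m □) □) ≗ region i onlyY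
  won□′ v rewrite proj₁ first □ v | A≗ v = ∨-identityʳ _

UpToXRun : ℕ → Set
UpToXRun i = ∀ {n} k {S : VSet n} → index i kx < k → index i kx < n → S ≗ region i upToX →
  Yields i upToX∖prevY onlyPrevY (2 ^ i) (zielonka (ladder n) k S)

upToX-run-zero : UpToXRun 0
upToX-run-zero {n} (suc k) {S} _ hx S≗ =
  subst (Yields 0 upToX∖prevY onlyPrevY 1) (sym (trans unfold (zielonkaStep-won G k S m ◇ opp-empty)))
        (yields won◇′ (λ v → sym (region-empty-level0 onlyPrevY (λ _ → refl) refl v)) (s≤s z≤n))
  where
  G = ladder n
  m = ladderPrio 0 kx
  AT = byZone ∅ₖ ∅ₖ xₖ ∅ₖ ∅ₖ
  unfold = zielonka-unfold-cur 0 upToX S≗ k kx hx refl refl refl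
  A≗ = Attractor.attr-topAtCur 0 upToX S≗ refl (zInRange-prev 0 upToX refl refl refl hx) ◇ kx AT refl refl refl
  first = zielonka-empty G k (S ∖ topAttr G S m ◇)
            (region-empty-level0 (upToX ∖ᴾ AT) (∖-region≐ 0 upToX AT (upToX ∖ᴾ AT) S≗ A≗ refl) refl)
  opp-empty : isEmpty (proj₁ (firstCall G k S m ◇) □) ≡ true
  opp-empty = isEmpty-true _ (proj₁ first □)
  won◇′ : (topAttr G S m ◇ ∪ proj₁ (firstCall G k S m ◇) ◇) ≗ region 0 upToX∖prevY
  won◇′ v rewrite proj₁ first ◇ v | ∨-identityʳ (topAttr G S m ◇ v) =
    trans (A≗ v) (region-≐-level0 AT upToX∖prevY refl v)

module Level (i : ℕ) (upToX-run : UpToXRun i) where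

  upToZ-run : ∀ {n} k {S : VSet n} → index i ky < k → index i kz < n → S ≗ region i upToZ →
    Yields i upToZ∖y onlyY (2 ^ i) (zielonka (ladder n) k S)
  upToZ-run {n} (suc k) {S} (s≤s hk) hz S≗ =
    subst (Yields i upToZ∖y onlyY (2 ^ i)) (sym (trans unfold (zielonkaStep-split G k S m □ opp-nonempty)))
          (yields won◇′ (won□ second) (≤-trans (calls first) (≤-trans (m≤m+n _ _) (n≤1+n _))))
    where
    G = ladder n
    m = ladderPrio i ky
    hx = <-trans (x<y i) (<-trans (y<z i) hz)
    inRange = zInRange-cur i upToZ refl refl hz
    unfold = zielonka-unfold-cur i upToZ S≗ k ky (<-trans (y<z i) hz) refl refl (playerOf-y i)
    AT = byZone ∅ₖ ∅ₖ yzₖ ∅ₖ ∅ₖ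
    A≗ = Attractor.attr-topAtCur i upToZ S≗ refl inRange □ ky AT refl refl refl
    first = upToX-run k (≤-trans (x<y i) hk) hx (∖-region≐ i upToZ AT upToX S≗ A≗ refl)
    opp-nonempty : isEmpty (proj₁ (firstCall G k S m □) ◇) ≡ false
    opp-nonempty = isEmpty-cur i upToX∖prevY kx (won◇ first) hx refl
    B≗ : oppAttr G k S m □ ≗ region i upToZ∖y
    B≗ = Attractor.iterate-twoSteps i upToZ S≗ refl inRange ◇ (upToX∖prevY ∩ᴾ upToZ)
           (byZone xyz xzₖ xzₖ ∅ₖ ∅ₖ) upToZ∖y
           (∩-region i upToX∖prevY upToZ (won◇ first) S≗) refl refl refl refl refl refl n
           (≤-trans (2≤index-z i) (<⇒≤ hz))
    second = onlyY-run i k (≤-trans (s≤s z≤n) (≤-trans (x<y i) hk)) hz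
               (∖-region≐ i upToZ upToZ∖y onlyY S≗ B≗ refl)
    won◇′ : (proj₁ (secondCall G k S m □) ◇ ∪ oppAttr G k S m □) ≗ region i upToZ∖y
    won◇′ = ∪-region≐ i emptyᴾ upToZ∖y upToZ∖y (won◇ second) B≗ refl

  upToZ∖y-run : ∀ {n} k {S : VSet n} → index i ky < k → index i kz < n → S ≗ region i upToZ∖y →
    Yields i upToZ∖y emptyᴾ (2 ^ i) (zielonka (ladder n) k S)
  upToZ∖y-run {n} (suc k) {S} (s≤s hk) hz S≗ =
    subst (Yields i upToZ∖y emptyᴾ (2 ^ i)) (sym (trans unfold (zielonkaStep-split G k S m □ opp-nonempty)))
          (yields won◇′ (λ v → trans (proj₁ second □ v) (sym (region-nowhere i emptyᴾ refl v)))
                  (≤-trans (calls first) (≤-trans (m≤m+n _ _) (n≤1+n _))))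
    where
    G = ladder n
    m = ladderPrio i kz
    hx = <-trans (x<y i) (<-trans (y<z i) hz)
    inRange = zInRange-cur i upToZ∖y refl refl hz
    unfold = zielonka-unfold-cur i upToZ∖y S≗ k kz hz refl refl (playerOf-z i)
    AT = byZone ∅ₖ ∅ₖ zₖ ∅ₖ ∅ₖ
    A≗ = Attractor.attr-topAtCur i upToZ∖y S≗ refl inRange □ kz AT refl refl refl
    first = upToX-run k (≤-trans (x<y i) hk) hx (∖-region≐ i upToZ∖y AT upToX S≗ A≗ refl)
    opp-nonempty : isEmpty (proj₁ (firstCall G k S m □) ◇) ≡ false
    opp-nonempty = isEmpty-cur i upToX∖prevY kx (won◇ first) hx refl
    B≗ : oppAttr G k S m □ ≗ region i upToZ∖y
    B≗ = Attractor.iterate-twoSteps i upToZ∖y S≗ refl inRange ◇ (upToX∖prevY ∩ᴾ upToZ∖y)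
           (byZone xyz xzₖ xzₖ ∅ₖ ∅ₖ) upToZ∖y
           (∩-region i upToX∖prevY upToZ∖y (won◇ first) S≗) refl refl refl refl refl refl n
           (≤-trans (2≤index-z i) (<⇒≤ hz))
    second = zielonka-empty G k (S ∖ oppAttr G k S m □)
               (region-empty i emptyᴾ (∖-region≐ i upToZ∖y upToZ∖y emptyᴾ S≗ B≗ refl) refl)
    won◇′ : (proj₁ (secondCall G k S m □) ◇ ∪ oppAttr G k S m □) ≗ region i upToZ∖y
    won◇′ v rewrite proj₁ second ◇ v = B≗ v

  upToNextX∖y-run : ∀ {n} k {S : VSet n} → index i kz < k → index (suc i) kx < n →
    S ≗ region i upToNextX∖y →
    Yields i upToNextX∖y emptyᴾ (2 ^ i) (zielonka (ladder n) k S)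
  upToNextX∖y-run {n} (suc k) {S} (s≤s hk) hx′ S≗ =
    subst (Yields i upToNextX∖y emptyᴾ (2 ^ i)) (sym (trans unfold (zielonkaStep-won G k S m ◇ opp-empty)))
          (yields won◇′ (λ v → sym (region-nowhere i emptyᴾ refl v)) (≤-trans (calls first) (n≤1+n _)))
    where
    G = ladder n
    m = ladderPrio (suc i) kx
    hz = <-trans (index-block-< kz kx (n<1+n i)) hx′
    inRange = zInRange-cur i upToNextX∖y refl refl hz
    unfold = zielonka-unfold-next i upToNextX∖y S≗ k kx hx′ refl refl (playerOf-x (suc i))
    AT = byZone ∅ₖ ∅ₖ ∅ₖ xₖ ∅ₖ
    A≗ = Attractor.attr-topAtNext i upToNextX∖y S≗ refl inRange ◇ kx AT refl refl refl
    first = upToZ∖y-run k (≤-trans (y<z i) hk) hz (∖-region≐ i upToNextX∖y AT upToZ∖y S≗ A≗ refl)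
    opp-empty : isEmpty (proj₁ (firstCall G k S m ◇) □) ≡ true
    opp-empty = isEmpty-region i emptyᴾ (won□ first) refl
    won◇′ : (topAttr G S m ◇ ∪ proj₁ (firstCall G k S m ◇) ◇) ≗ region i upToNextX∖y
    won◇′ = ∪-region≐ i AT upToZ∖y upToNextX∖y A≗ (won◇ first) refl

  upToNextX-run : ∀ {n} k {S : VSet n} → index (suc i) kx < k → index (suc i) kx < n →
    S ≗ region i upToNextX →
    Yields i upToNextX∖y onlyY (2 ^ suc i) (zielonka (ladder n) k S)
  upToNextX-run {n} (suc k) {S} (s≤s hk) hx′ S≗ =
    subst (Yields i upToNextX∖y onlyY (2 ^ suc i))
          (sym (trans unfold (zielonkaStep-split G k S m ◇ opp-nonempty)))
          (yields (won◇ second) won□′ calls′)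
    where
    G = ladder n
    m = ladderPrio (suc i) kx
    hz = <-trans (index-block-< kz kx (n<1+n i)) hx′
    hzk = ≤-trans (index-block-< kz kx (n<1+n i)) hk
    inRange = zInRange-cur i upToNextX refl refl hz
    unfold = zielonka-unfold-next i upToNextX S≗ k kx hx′ refl refl (playerOf-x (suc i))
    AT = byZone ∅ₖ ∅ₖ ∅ₖ xₖ ∅ₖ
    A≗ = Attractor.attr-topAtNext i upToNextX S≗ refl inRange ◇ kx AT refl refl refl
    first = upToZ-run k (≤-trans (s≤s (<⇒≤ (y<z i))) hzk) hz (∖-region≐ i upToNextX AT upToZ S≗ A≗ refl)
    opp-nonempty : isEmpty (proj₁ (firstCall G k S m ◇) □) ≡ false
    opp-nonempty = isEmpty-cur i onlyY ky (won□ first) (<-trans (y<z i) hz) refl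
    B≗ : oppAttr G k S m ◇ ≗ region i onlyY
    B≗ = Attractor.iterate-fixpoint i upToNextX S≗ refl inRange □ onlyY
           (recast i (onlyY ∩ᴾ upToNextX) onlyY (∩-region i onlyY upToNextX (won□ first) S≗) refl)
           refl refl n
    second = upToNextX∖y-run k hzk hx′ (∖-region≐ i upToNextX onlyY upToNextX∖y S≗ B≗ refl)
    won□′ : (proj₁ (secondCall G k S m ◇) □ ∪ oppAttr G k S m ◇) ≗ region i onlyY
    won□′ = ∪-region≐ i emptyᴾ onlyY onlyY (won□ second) B≗ refl
    calls′ : 2 ^ suc i ≤ suc (proj₂ (firstCall G k S m ◇) + proj₂ (secondCall G k S m ◇))
    calls′ rewrite +-identityʳ (2 ^ i) = ≤-trans (+-mono-≤ (calls first) (calls second)) (n≤1+n _)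

upToX-run : ∀ i → UpToXRun i
upToX-run zero    = upToX-run-zero
upToX-run (suc i) k hk hx S≗ =
  yields (≗-trans (won◇ run) (λ v → sym (region-shiftᴾ i upToX∖prevY upToNextX∖y (λ _ → refl) refl v)))
         (≗-trans (won□ run) (λ v → sym (region-shiftᴾ i onlyPrevY onlyY (λ _ → refl) refl v)))
         (calls run)
  where
  run = Level.upToNextX-run i (upToX-run i) k hk hx
          (≗-trans S≗ (region-shiftᴾ i upToX upToNextX (λ _ → refl) refl))

upToY-calls : ∀ i {n} k {S : VSet n} → index i ky < k → index i ky < n → S ≗ region i upToY →
  2 ^ i ≤ proj₂ (zielonka (ladder n) k S)
upToY-calls i {n} (suc k) {S} (s≤s hk) hy S≗ =
  subst (λ r → 2 ^ i ≤ proj₂ r) (sym unfold)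
        (≤-trans (≤-trans (calls first) (n≤1+n _)) (zielonkaStep-calls G k S m □))
  where
  G = ladder n
  m = ladderPrio i ky
  hx = <-trans (x<y i) hy
  unfold = zielonka-unfold-cur i upToY S≗ k ky hy refl refl (playerOf-y i)
  AT = byZone ∅ₖ ∅ₖ yₖ ∅ₖ ∅ₖ
  A≗ = Attractor.attr-topAtCur i upToY S≗ refl (zInRange-prev i upToY refl refl refl hx) □ ky AT refl refl refl
  first = upToX-run i k (≤-trans (x<y i) hk) hx (∖-region≐ i upToY AT upToX S≗ A≗ refl)

index-≤-inv : ∀ c k b k′ → index c k ≤ index b k′ → c < b ⊎ (c ≡ b × kindIndex k ≤ kindIndex k′)
index-≤-inv zero    k zero    k′ h = inj₂ (refl , h)
index-≤-inv zero    k (suc b) k′ h = inj₁ (s≤s z≤n)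
index-≤-inv (suc c) k zero    kx ()
index-≤-inv (suc c) k zero    ky (s≤s ())
index-≤-inv (suc c) k zero    kz (s≤s (s≤s ()))
index-≤-inv (suc c) k (suc b) k′ (s≤s (s≤s (s≤s h))) with index-≤-inv c k b k′ h
... | inj₁ c<b        = inj₁ (s≤s c<b)
... | inj₂ (refl , l) = inj₂ (refl , l)

xyz-true : ∀ k → xyz k ≡ true
xyz-true kx = refl
xyz-true ky = refl
xyz-true kz = refl

full-prefix : ∀ b k′ → full ≗ region {suc (index b k′)} b (prefix k′)
full-prefix b k′ v with index-≤-inv (block v) (kind v) b k′ v≤
  where
  v≤ : index (block v) (kind v) ≤ index b k′
  v≤ with toℕ<n v
  ... | s≤s h = subst (_≤ index b k′) (toℕ-index v) h
... | inj₁ c<b with <⇒zone≡lo⊎prev (block v) b c<b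
...   | inj₁ e = sym (trans (cong (λ r → prefix k′ r (kind v)) e) (xyz-true (kind v)))
...   | inj₂ e = sym (trans (cong (λ r → prefix k′ r (kind v)) e) (xyz-true (kind v)))
full-prefix b k′ v | inj₂ (e , l) =
  sym (trans (cong (λ r → prefix k′ r (kind v)) (trans (cong (λ c → zone c b) e) (zone-self b)))
             (Equivalence.to T-≡ (≤⇒≤ᵇ l)))

zielonkaCalls-ladder : ∀ b k′ → 2 ^ b ≤ zielonkaCalls (ladder (suc (index b k′)))
zielonkaCalls-ladder b kx = calls (upToX-run b (suc (index b kx)) ≤-refl ≤-refl (full-prefix b kx))
zielonkaCalls-ladder b ky = upToY-calls b (suc (index b ky)) ≤-refl ≤-refl (full-prefix b ky)
zielonkaCalls-ladder b kz =
  calls (Level.upToZ-run b (upToX-run b) (suc (index b kz)) (s≤s (<⇒≤ (y<z b))) ≤-refl (full-prefix b kz))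

index<3*suc : ∀ b k → suc (index b k) ≤ suc b * 3
index<3*suc zero    kx = s≤s z≤n
index<3*suc zero    ky = s≤s (s≤s z≤n)
index<3*suc zero    kz = s≤s (s≤s (s≤s z≤n))
index<3*suc (suc b) k  = s≤s (s≤s (s≤s (index<3*suc b k)))

zielonkaCalls-ladder-/3 : ∀ t → 2 ^ (suc t / 3) ≤ 2 * zielonkaCalls (ladder (suc t))
zielonkaCalls-ladder-/3 t =
  subst (λ s → 2 ^ (suc s / 3) ≤ 2 * zielonkaCalls (ladder (suc s))) (index-locate t)
        (bound (proj₁ (locate t)) (proj₂ (locate t)))
  where
  bound : ∀ b k → 2 ^ (suc (index b k) / 3) ≤ 2 * zielonkaCalls (ladder (suc (index b k)))
  bound b k = ≤-trans (^-monoʳ-≤ 2 exponent) (*-monoʳ-≤ 2 (zielonkaCalls-ladder b k))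
    where
    exponent : suc (index b k) / 3 ≤ suc b
    exponent = subst (suc (index b k) / 3 ≤_) (m*n/n≡m (suc b) 3) (/-monoˡ-≤ 3 (index<3*suc b k))

theorem4 : ∃ λ (c : ℕ) → ∃ λ (N : ℕ) → ∀ (n : ℕ) → N ≤ n →
    ∃ λ (G : Game n) → Dull G × (2 ^ (n / 3) ≤ c * zielonkaCalls G)
theorem4 = 2 , 1 , λ where
  (suc t) _ → ladder (suc t) , ladder-dull (suc t) , zielonkaCalls-ladder-/3 t
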